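{- A total function $h:\omega\to\omega$ is truth-table equivalent to the characteristic function of its own graph $\{\langle x,h(x)\rangle: x\in\omega\}$ if and only if there exists a total computable function $b$ such that $h(x)\le b(x)$ for every $x$.
   Context: Subsets of $\omega^2$ are identified with subsets of $\omega$ via a fixed computable pairing $\langle\cdot,\cdot\rangle$. For total $\alpha,\beta:\omega\to\omega$, writing $D_e$ for the finite set with canonical (strong) index $e$: $\alpha\le_{tt}\beta$ if there are total computable $p,q$ with $\alpha(x)=q(x,\beta\restriction D_{p(x)})$ for all $x$; truth-table equivalence means $\le_{tt}$ in both directions. -}

module Defs where

open import Data.Nat using (ℕ; zero; suc; _+_; _*_; _^_; _≤_; _<_; _≟_)
open import Data.Nat.DivMod using (_/_; _%_)
open import Data.Fin using (Fin)
open import Data.Vec using (Vec; []; _∷_; lookup)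
open import Data.Product using (Σ; ∃; _×_; _,_)
open import Relation.Binary.PropositionalEquality using (_≡_)
open import Relation.Nullary using (yes; no)

data PR : ℕ → Set where
  Z    : ∀ {n} → PR n
  S    : PR 1
  P    : ∀ {n} → Fin n → PR n
  comp : ∀ {m n} → PR m → Vec (PR n) m → PR n
  prec : ∀ {n} → PR n → PR (suc (suc n)) → PR (suc n)
  mu   : ∀ {n} → PR (suc n) → PR n

mutual
  data _[_]⇓_ : ∀ {n} → PR n → Vec ℕ n → ℕ → Set where
    evZ    : ∀ {n} {xs : Vec ℕ n} → Z [ xs ]⇓ 0
    evS    : ∀ {x} → S [ x ∷ [] ]⇓ suc x
    evP    : ∀ {n} {i : Fin n} {xs} → P i [ xs ]⇓ lookup xs i
    evComp : ∀ {m n} {f : PR m} {gs : Vec (PR n) m} {xs ys z} →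
             gs [ xs ]⇓* ys → f [ ys ]⇓ z → comp f gs [ xs ]⇓ z
    evPrec0 : ∀ {n} {f : PR n} {g} {xs z} →
              f [ xs ]⇓ z → prec f g [ 0 ∷ xs ]⇓ z
    evPrecS : ∀ {n} {f : PR n} {g} {xs k r z} →
              prec f g [ k ∷ xs ]⇓ r → g [ k ∷ r ∷ xs ]⇓ z →
              prec f g [ suc k ∷ xs ]⇓ z
    evMu   : ∀ {n} {f : PR (suc n)} {xs y} →
             f [ y ∷ xs ]⇓ 0 →
             (∀ z → z < y → Σ ℕ (λ w → f [ z ∷ xs ]⇓ suc w)) →
             mu f [ xs ]⇓ y

  data _[_]⇓*_ : ∀ {m n} → Vec (PR n) m → Vec ℕ n → Vec ℕ m → Set where
    ev[]  : ∀ {n} {xs : Vec ℕ n} → [] [ xs ]⇓* []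
    ev∷   : ∀ {m n} {g : PR n} {gs : Vec (PR n) m} {xs y ys} →
            g [ xs ]⇓ y → gs [ xs ]⇓* ys → (g ∷ gs) [ xs ]⇓* (y ∷ ys)

Computable₁ : (ℕ → ℕ) → Set
Computable₁ f = Σ (PR 1) (λ c → ∀ x → c [ x ∷ [] ]⇓ f x)

Computable₂ : (ℕ → ℕ → ℕ) → Set
Computable₂ f = Σ (PR 2) (λ c → ∀ x y → c [ x ∷ y ∷ [] ]⇓ f x y)

tri : ℕ → ℕ
tri zero    = 0
tri (suc s) = suc s + tri s

pair : ℕ → ℕ → ℕ
pair a b = tri (a + b) + a

-- inverse, by enumerating pairs in the order 0,1,2,... of their codes
nextPair : ℕ × ℕ → ℕ × ℕ
nextPair (a , zero)  = (0 , suc a)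
nextPair (a , suc b) = (suc a , b)

unpair : ℕ → ℕ × ℕ
unpair zero    = (0 , 0)
unpair (suc n) = nextPair (unpair n)

graphChar : (ℕ → ℕ) → ℕ → ℕ
graphChar h n with unpair n
... | (x , y) with h x ≟ y
...   | yes _ = 1
...   | no  _ = 0

-- Canonical (strong) indices: n ∈ D_e iff bit n of e is 1.

testBit : ℕ → ℕ → ℕ
testBit zero    e = e % 2
testBit (suc n) e = testBit n (e / 2)

-- canonical index of the finite set of pairs {⟨n, β n⟩ : n ∈ D_e, n < k}
restrictBelow : (ℕ → ℕ) → ℕ → ℕ → ℕ
restrictBelow β e zero    = 0
restrictBelow β e (suc k) =
  restrictBelow β e k + testBit k e * 2 ^ pair k (β k)

-- code of β ↾ D_e: the canonical index of the finite graph of β ↾ D_e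
-- (every element of D_e is < e, so bounding by e is harmless)
restrict : (ℕ → ℕ) → ℕ → ℕ
restrict β e = restrictBelow β e e

_≤tt_ : (ℕ → ℕ) → (ℕ → ℕ) → Set
α ≤tt β = Σ (ℕ → ℕ) λ p → Σ (ℕ → ℕ → ℕ) λ q →
          Computable₁ p × Computable₂ q × (∀ x → α x ≡ q x (restrict β (p x)))

_≡tt_ : (ℕ → ℕ) → (ℕ → ℕ) → Set
α ≡tt β = (α ≤tt β) × (β ≤tt α)

-- The code restrict β e of β ↾ D_e has the binary digit ⟨k, β k⟩ set exactly for k ∈ D_e.
-- Taking D_e = {0, …, N − 1}, whose index is 2^N − 1, the digit ⟨x, y⟩ of the code of h ↾ N
-- (N > ⟨x, y⟩) is graphChar h ⟨x, y⟩, so graphChar h ≤tt h.  Given a computable bound b, h x is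
-- the unique y ≤ b x whose digit ⟨⟨x, y⟩, 1⟩ is set in the code of graphChar h ↾ (⟨x, b x⟩ + 1),
-- i.e. h x = Σ_{y ≤ b x} y · digit, so h ≤tt graphChar h.  Conversely, a tt-reduction of α to a
-- {0,1}-valued β only ever evaluates q x at codes below the computable bound Σ_{k<e} 2^⟨k,1⟩
-- (e = p x), so the sum of these finitely many values of q x bounds α x computably.

module Submission where

open import Defs
open import Data.Nat using (ℕ; _≤_)
open import Data.Product using (Σ; _×_)
open import Function.Bundles using (_⇔_)

open import Data.Nat using (zero; suc; _+_; _*_; _^_; _∸_; _<_; _≟_; z≤n; s≤s; s≤s⁻¹)
open import Data.Nat.DivMod
open import Data.Nat.Divisibility using (n∣m*n)
open import Data.Nat.GeneralisedArithmetic using (fold; iterate; iterate-is-fold)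
open import Data.Nat.Properties
open import Data.Fin using (Fin; #_) renaming (zero to fzero; suc to fsuc)
open import Data.Vec using (Vec; []; _∷_; head; tail; lookup; tabulate)
open import Data.Vec.Properties using (tabulate∘lookup)
open import Data.Product using (_,_; proj₁; proj₂; uncurry)
open import Data.Product.Properties using (×-≡,≡←≡)
open import Data.Sum using (inj₁; inj₂)
open import Function.Base using (_∘_)
open import Function.Bundles using (mk⇔)
open import Relation.Binary.PropositionalEquality
open import Relation.Nullary using (Dec; yes; no; contradiction)

private
  variable
    n m : ℕ

-- Cantor pairing

pair-nextPair : ∀ p → uncurry pair (nextPair p) ≡ suc (uncurry pair p)
pair-nextPair (a , zero) = cong suc (begin
  a + tri a + 0     ≡⟨ +-identityʳ (a + tri a) ⟩
  a + tri a         ≡⟨ +-comm a (tri a) ⟩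
  tri a + a         ≡⟨ cong (λ s → tri s + a) (+-identityʳ a) ⟨
  tri (a + 0) + a   ∎)
  where open ≡-Reasoning
pair-nextPair (a , suc b) = begin
  tri (suc (a + b)) + suc a     ≡⟨ cong (λ s → tri s + suc a) (+-suc a b) ⟨
  tri (a + suc b) + suc a       ≡⟨ +-suc (tri (a + suc b)) a ⟩
  suc (tri (a + suc b) + a)     ∎
  where open ≡-Reasoning

pair-unpair : ∀ n → uncurry pair (unpair n) ≡ n
pair-unpair zero    = refl
pair-unpair (suc n) = trans (pair-nextPair (unpair n)) (cong suc (pair-unpair n))

unpair-pair : ∀ n p → uncurry pair p ≡ n → unpair n ≡ p
unpair-pair zero    (zero  , zero)  _  = refl
unpair-pair zero    (suc a , b)     eq = contradiction (trans (sym (pair-nextPair (a , suc b))) eq) λ ()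
unpair-pair zero    (zero  , suc b) eq = contradiction (trans (sym (pair-nextPair (b , zero))) eq) λ ()
unpair-pair (suc n) (zero  , zero)  ()
unpair-pair (suc n) (suc a , b)     eq =
  cong nextPair (unpair-pair n (a , suc b) (suc-injective (trans (sym (pair-nextPair (a , suc b))) eq)))
unpair-pair (suc n) (zero  , suc b) eq =
  cong nextPair (unpair-pair n (b , zero) (suc-injective (trans (sym (pair-nextPair (b , zero))) eq)))

pair-injective : ∀ {a b c d} → pair a b ≡ pair c d → a ≡ c × b ≡ d
pair-injective {a} {b} {c} {d} eq =
  ×-≡,≡←≡ (trans (sym (unpair-pair _ (a , b) refl)) (unpair-pair _ (c , d) (sym eq)))

m≤pair : ∀ a b → a ≤ pair a b
m≤pair a b = m≤n+m a (tri (a + b))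

tri-mono-≤ : ∀ {s t} → s ≤ t → tri s ≤ tri t
tri-mono-≤ {zero}          _         = z≤n
tri-mono-≤ {suc s} {suc t} (s≤s s≤t) = +-mono-≤ (s≤s s≤t) (tri-mono-≤ s≤t)

pair-monoʳ-≤ : ∀ a {b c} → b ≤ c → pair a b ≤ pair a c
pair-monoʳ-≤ a b≤c = +-monoˡ-≤ a (tri-mono-≤ (+-monoʳ-≤ a b≤c))

δ : ℕ → ℕ → ℕ
δ a b with a ≟ b
... | yes _ = 1
... | no  _ = 0

δ-refl : ∀ a → δ a a ≡ 1
δ-refl a with a ≟ a
... | yes _   = refl
... | no  a≢a = contradiction refl a≢a

δ-≢ : ∀ {a b} → a ≢ b → δ a b ≡ 0
δ-≢ {a} {b} a≢b with a ≟ b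
... | yes a≡b = contradiction a≡b a≢b
... | no  _   = refl

δ-δ : ∀ a b → δ (δ a b) 1 ≡ δ a b
δ-δ a b with a ≟ b
... | yes _ = refl
... | no  _ = refl

δ≤1 : ∀ a b → δ a b ≤ 1
δ≤1 a b with a ≟ b
... | yes _ = s≤s z≤n
... | no  _ = z≤n

graphChar-unpair : ∀ h n → graphChar h n ≡ δ (h (proj₁ (unpair n))) (proj₂ (unpair n))
graphChar-unpair h n with unpair n
... | (x , y) with h x ≟ y
...   | yes _ = refl
...   | no  _ = refl

graphChar-pair : ∀ h x y → graphChar h (pair x y) ≡ δ (h x) y
graphChar-pair h x y =
  trans (graphChar-unpair h (pair x y))
        (cong (λ (x′ , y′) → δ (h x′) y′) (unpair-pair _ (x , y) refl))

graphChar≤1 : ∀ h n → graphChar h n ≤ 1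
graphChar≤1 h n = subst (_≤ 1) (sym (graphChar-unpair h n)) (δ≤1 _ _)

-- Binary digits

[m+n*2]/2≡m/2+n : ∀ m n → (m + n * 2) / 2 ≡ m / 2 + n
[m+n*2]/2≡m/2+n m n = trans (+-distrib-/-∣ʳ m (n∣m*n n)) (cong (m / 2 +_) (m*n/n≡m n 2))

[2+n]%2≡n%2 : ∀ n → suc (suc n) % 2 ≡ n % 2
[2+n]%2≡n%2 n = trans (cong (_% 2) (+-comm 2 n)) ([m+n]%n≡m%n n 2)

[2+n]/2≡1+n/2 : ∀ n → suc (suc n) / 2 ≡ suc (n / 2)
[2+n]/2≡1+n/2 n = trans (cong (_/ 2) (+-comm 2 n)) (trans ([m+n*2]/2≡m/2+n n 1) (+-comm (n / 2) 1))

[1+n]%2≡1∸n%2 : ∀ n → suc n % 2 ≡ 1 ∸ n % 2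
[1+n]%2≡1∸n%2 zero          = refl
[1+n]%2≡1∸n%2 (suc zero)    = refl
[1+n]%2≡1∸n%2 (suc (suc n)) =
  trans ([2+n]%2≡n%2 (suc n)) (trans ([1+n]%2≡1∸n%2 n) (cong (1 ∸_) (sym ([2+n]%2≡n%2 n))))

[1+n]/2≡n/2+n%2 : ∀ n → suc n / 2 ≡ n / 2 + n % 2
[1+n]/2≡n/2+n%2 zero          = refl
[1+n]/2≡n/2+n%2 (suc zero)    = refl
[1+n]/2≡n/2+n%2 (suc (suc n)) = begin
  suc (suc (suc n)) / 2           ≡⟨ [2+n]/2≡1+n/2 (suc n) ⟩
  suc (suc n / 2)                 ≡⟨ cong suc ([1+n]/2≡n/2+n%2 n) ⟩
  suc (n / 2 + n % 2)             ≡⟨ cong₂ _+_ ([2+n]/2≡1+n/2 n) ([2+n]%2≡n%2 n) ⟨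
  suc (suc n) / 2 + suc (suc n) % 2 ∎
  where open ≡-Reasoning

testBit<2 : ∀ j e → testBit j e < 2
testBit<2 zero    e = m%n<n e 2
testBit<2 (suc j) e = testBit<2 j (e / 2)

testBit-0 : ∀ j → testBit j 0 ≡ 0
testBit-0 zero    = refl
testBit-0 (suc j) = testBit-0 j

*2^suc : ∀ b J → b * 2 ^ suc J ≡ b * 2 ^ J * 2
*2^suc b J = trans (cong (b *_) (*-comm 2 (2 ^ J))) (sym (*-assoc b (2 ^ J) 2))

/2-+-*2^suc : ∀ A b J → (A + b * 2 ^ suc J) / 2 ≡ A / 2 + b * 2 ^ J
/2-+-*2^suc A b J = trans (cong (λ c → (A + c) / 2) (*2^suc b J)) ([m+n*2]/2≡m/2+n A (b * 2 ^ J))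

testBit-+-*2^-≡ : ∀ {b} A J → b < 2 → testBit J A ≡ 0 → testBit J (A + b * 2 ^ J) ≡ b
testBit-+-*2^-≡ {b} A zero b<2 A₀≡0 = begin
  (A + b * 1) % 2               ≡⟨ cong (λ c → (A + c) % 2) (*-identityʳ b) ⟩
  (A + b) % 2                   ≡⟨ %-distribˡ-+ A b 2 ⟩
  (A % 2 + b % 2) % 2           ≡⟨ cong (λ r → (r + b % 2) % 2) A₀≡0 ⟩
  b % 2 % 2                     ≡⟨ m%n%n≡m%n b 2 ⟩
  b % 2                         ≡⟨ m<n⇒m%n≡m b<2 ⟩
  b                             ∎
  where open ≡-Reasoning
testBit-+-*2^-≡ {b} A (suc J) b<2 A_J≡0 =
  trans (cong (testBit J) (/2-+-*2^suc A b J)) (testBit-+-*2^-≡ (A / 2) J b<2 A_J≡0)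

testBit-+-*2^-≢ : ∀ {b} A J j → b < 2 → testBit J A ≡ 0 → j ≢ J →
                  testBit j (A + b * 2 ^ J) ≡ testBit j A
testBit-+-*2^-≢     A zero    zero    _   _      j≢J = contradiction refl j≢J
testBit-+-*2^-≢ {b} A zero    (suc j) b<2 A₀≡0 _   = cong (testBit j) (begin
  (A + b * 1) / 2               ≡⟨ cong (λ c → (A + c) / 2) (*-identityʳ b) ⟩
  (A + b) / 2                   ≡⟨ +-distrib-/ A b A%2+b%2<2 ⟩
  A / 2 + b / 2                 ≡⟨ cong (A / 2 +_) (m<n⇒m/n≡0 b<2) ⟩
  A / 2 + 0                     ≡⟨ +-identityʳ (A / 2) ⟩
  A / 2                         ∎)
  where
  open ≡-Reasoning
  A%2+b%2<2 : A % 2 + b % 2 < 2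
  A%2+b%2<2 = subst (_< 2) (sym (cong₂ _+_ A₀≡0 (m<n⇒m%n≡m b<2))) b<2
testBit-+-*2^-≢ {b} A (suc J) zero    _   _    _   =
  trans (cong (λ c → (A + c) % 2) (*2^suc b J)) ([m+kn]%n≡m%n A (b * 2 ^ J) 2)
testBit-+-*2^-≢ {b} A (suc J) (suc j) b<2 A_J≡0 j≢J =
  trans (cong (testBit j) (/2-+-*2^suc A b J))
        (testBit-+-*2^-≢ (A / 2) J j b<2 A_J≡0 (j≢J ∘ cong suc))

-- mask N = 2^N − 1, the canonical index of {0, …, N − 1}.
mask : ℕ → ℕ
mask zero    = 0
mask (suc N) = 1 + mask N * 2

testBit-mask : ∀ {k N} → k < N → testBit k (mask N) ≡ 1
testBit-mask {zero}  {suc N} _         = [m+kn]%n≡m%n 1 (mask N) 2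
testBit-mask {suc k} {suc N} (s≤s k<N) =
  trans (cong (testBit k) ([m+n*2]/2≡m/2+n 1 (mask N))) (testBit-mask k<N)

n≤mask : ∀ N → N ≤ mask N
n≤mask zero    = z≤n
n≤mask (suc N) = s≤s (≤-trans (n≤mask N) (m≤m*n (mask N) 2))

module _ (β : ℕ → ℕ) (e : ℕ) where

  private
    R : ℕ → ℕ
    R = restrictBelow β e

    graphPoint : ℕ → ℕ
    graphPoint K = pair K (β K)

    unchanged : ∀ K j → testBit (graphPoint K) (R K) ≡ 0 → j ≢ graphPoint K →
                testBit j (R (suc K)) ≡ testBit j (R K)
    unchanged K j = testBit-+-*2^-≢ (R K) (graphPoint K) j (testBit<2 K e)

    pair-≢ : ∀ {k K} y → k ≢ K → pair k y ≢ graphPoint K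
    pair-≢ {k} y k≢K eq = k≢K (proj₁ (pair-injective {k} eq))

    pair-≢ʳ : ∀ k {y} → β k ≢ y → pair k y ≢ graphPoint k
    pair-≢ʳ k βk≢y eq = βk≢y (sym (proj₂ (pair-injective {k} {_} {k} eq)))

  testBit-restrictBelow-fresh : ∀ {K} k y → K ≤ k → testBit (pair k y) (restrictBelow β e K) ≡ 0
  testBit-restrictBelow-fresh {zero}  k y _   = testBit-0 (pair k y)
  testBit-restrictBelow-fresh {suc K} k y K<k =
    trans (unchanged K (pair k y) (testBit-restrictBelow-fresh K (β K) ≤-refl) (pair-≢ y (>⇒≢ K<k)))
          (testBit-restrictBelow-fresh k y (<⇒≤ K<k))

  testBit-restrictBelow : ∀ {K} k y → k < K →
                          testBit (pair k y) (restrictBelow β e K) ≡ testBit k e * δ (β k) y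
  testBit-restrictBelow {suc K} k y k<1+K with m<1+n⇒m<n∨m≡n k<1+K
  ... | inj₁ k<K =
    trans (unchanged K (pair k y) (testBit-restrictBelow-fresh K (β K) ≤-refl) (pair-≢ y (<⇒≢ k<K)))
          (testBit-restrictBelow k y k<K)
  ... | inj₂ refl = lastEntry (β k ≟ y)
    where
    open ≡-Reasoning
    fresh : testBit (graphPoint k) (R k) ≡ 0
    fresh = testBit-restrictBelow-fresh k (β k) ≤-refl

    lastEntry : Dec (β k ≡ y) → testBit (pair k y) (R (suc k)) ≡ testBit k e * δ (β k) y
    lastEntry (yes refl) = begin
      testBit (graphPoint k) (R (suc k))   ≡⟨ testBit-+-*2^-≡ (R k) (graphPoint k) (testBit<2 k e) fresh ⟩
      testBit k e                          ≡⟨ *-identityʳ (testBit k e) ⟨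
      testBit k e * 1                      ≡⟨ cong (testBit k e *_) (δ-refl (β k)) ⟨
      testBit k e * δ (β k) (β k)          ∎
    lastEntry (no βk≢y) = begin
      testBit (pair k y) (R (suc k))   ≡⟨ unchanged k (pair k y) fresh (pair-≢ʳ k βk≢y) ⟩
      testBit (pair k y) (R k)         ≡⟨ testBit-restrictBelow-fresh k y ≤-refl ⟩
      0                                ≡⟨ *-zeroʳ (testBit k e) ⟨
      testBit k e * 0                  ≡⟨ cong (testBit k e *_) (δ-≢ βk≢y) ⟨
      testBit k e * δ (β k) y          ∎

testBit-restrict-mask : ∀ β {k N} y → k < N → testBit (pair k y) (restrict β (mask N)) ≡ δ (β k) y
testBit-restrict-mask β {k} {N} y k<N = begin
  testBit (pair k y) (restrict β (mask N))
    ≡⟨ testBit-restrictBelow β (mask N) k y (<-≤-trans k<N (n≤mask N)) ⟩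
  testBit k (mask N) * δ (β k) y            ≡⟨ cong (_* δ (β k) y) (testBit-mask k<N) ⟩
  1 * δ (β k) y                             ≡⟨ *-identityˡ (δ (β k) y) ⟩
  δ (β k) y                                 ∎
  where open ≡-Reasoning

sumBelow : (ℕ → ℕ) → ℕ → ℕ
sumBelow f zero    = 0
sumBelow f (suc n) = sumBelow f n + f n

sumBelow-cong : ∀ {f g} n → (∀ i → i < n → f i ≡ g i) → sumBelow f n ≡ sumBelow g n
sumBelow-cong zero    _   = refl
sumBelow-cong (suc n) f≗g =
  cong₂ _+_ (sumBelow-cong n (λ i i<n → f≗g i (m<n⇒m<1+n i<n))) (f≗g n ≤-refl)

sumBelow-zero : ∀ {f} n → (∀ i → i < n → f i ≡ 0) → sumBelow f n ≡ 0
sumBelow-zero zero    _    = refl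
sumBelow-zero (suc n) f≗0 =
  cong₂ _+_ (sumBelow-zero n (λ i i<n → f≗0 i (m<n⇒m<1+n i<n))) (f≗0 n ≤-refl)

sumBelow-single : ∀ {f v} n → v < n → (∀ i → i ≢ v → f i ≡ 0) → sumBelow f n ≡ f v
sumBelow-single {f} {v} (suc n) v<1+n f≗0 with m<1+n⇒m<n∨m≡n v<1+n
... | inj₁ v<n  =
  trans (cong₂ _+_ (sumBelow-single n v<n f≗0) (f≗0 n (>⇒≢ v<n))) (+-identityʳ (f v))
... | inj₂ refl = cong (_+ f n) (sumBelow-zero n (λ i i<n → f≗0 i (<⇒≢ i<n)))

sumBelow-*δ : ∀ {v} n → v < n → sumBelow (λ y → y * δ v y) n ≡ v
sumBelow-*δ {v} n v<n = begin
  sumBelow (λ y → y * δ v y) n   ≡⟨ sumBelow-single n v<n off-diagonal ⟩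
  v * δ v v                     ≡⟨ cong (v *_) (δ-refl v) ⟩
  v * 1                         ≡⟨ *-identityʳ v ⟩
  v                             ∎
  where
  open ≡-Reasoning
  off-diagonal : ∀ y → y ≢ v → y * δ v y ≡ 0
  off-diagonal y y≢v = trans (cong (y *_) (δ-≢ (y≢v ∘ sym))) (*-zeroʳ y)

f≤sumBelow : ∀ f {i} n → i < n → f i ≤ sumBelow f n
f≤sumBelow f (suc n) i<1+n with m<1+n⇒m<n∨m≡n i<1+n
... | inj₁ i<n  = ≤-trans (f≤sumBelow f n i<n) (m≤m+n (sumBelow f n) (f n))
... | inj₂ refl = m≤n+m (f n) (sumBelow f n)

restrictBelow≤ : ∀ {β} e K → (∀ k → β k ≤ 1) → restrictBelow β e K ≤ sumBelow (λ k → 2 ^ pair k 1) K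
restrictBelow≤     e zero    _   = z≤n
restrictBelow≤ {β} e (suc K) β≤1 = +-mono-≤ (restrictBelow≤ e K β≤1) (begin
  testBit K e * 2 ^ pair K (β K)
    ≤⟨ *-mono-≤ (s≤s⁻¹ (testBit<2 K e)) (^-monoʳ-≤ 2 (pair-monoʳ-≤ K (β≤1 K))) ⟩
  1 * 2 ^ pair K 1                 ≡⟨ *-identityˡ (2 ^ pair K 1) ⟩
  2 ^ pair K 1                     ∎)
  where open ≤-Reasoning

-- Primitive recursive functions

Computable : (n : ℕ) → (Vec ℕ n → ℕ) → Set
Computable n F = Σ (PR n) λ c → ∀ xs → c [ xs ]⇓ F xs

Computable* : (n m : ℕ) → (Vec ℕ n → Vec ℕ m) → Set
Computable* n m G = Σ (Vec (PR n) m) λ cs → ∀ xs → cs [ xs ]⇓* G xs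

[]ᶜ : Computable* n 0 (λ _ → [])
[]ᶜ = [] , λ _ → ev[]

infixr 5 _∷ᶜ_
_∷ᶜ_ : ∀ {F G} → Computable n F → Computable* n m G →
       Computable* n (suc m) (λ xs → F xs ∷ G xs)
(c , evc) ∷ᶜ (cs , evcs) = c ∷ cs , λ xs → ev∷ (evc xs) (evcs xs)

computable₁ : ∀ {F} → Computable 1 F → Computable₁ (λ x → F (x ∷ []))
computable₁ (c , evc) = c , λ x → evc (x ∷ [])

computable₂ : ∀ {F} → Computable 2 F → Computable₂ (λ x y → F (x ∷ y ∷ []))
computable₂ (c , evc) = c , λ x y → evc (x ∷ y ∷ [])

computable₂-ext : ∀ {f g} → Computable₂ f → (∀ x y → f x y ≡ g x y) → Computable₂ g
computable₂-ext (c , evc) f≗g = c , λ x y → subst (c [ x ∷ y ∷ [] ]⇓_) (f≗g x y) (evc x y)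

var : (i : Fin n) → Computable n (λ xs → lookup xs i)
var i = P i , λ _ → evP

lookups : (σ : Fin m → Fin n) → Computable* n m (λ xs → tabulate (lookup xs ∘ σ))
lookups {zero}  σ = []ᶜ
lookups {suc m} σ = var (σ fzero) ∷ᶜ lookups (σ ∘ fsuc)

compose : ∀ {F G} → Computable m F → Computable* n m G → Computable n (λ xs → F (G xs))
compose {G = G} (c , evc) (cs , evcs) = comp c cs , λ xs → evComp (evcs xs) (evc (G xs))

app₁ : ∀ {f G} → Computable₁ f → Computable n G → Computable n (λ xs → f (G xs))
app₁ {f = f} (c , evc) cG = compose {F = f ∘ head} (c , λ { (x ∷ []) → evc x }) (cG ∷ᶜ []ᶜ)

app₂ : ∀ {f G H} → Computable₂ f → Computable n G → Computable n H →
       Computable n (λ xs → f (G xs) (H xs))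
app₂ {f = f} (c , evc) cG cH = compose {F = λ xs → f (head xs) (lookup xs (# 1))}
  (c , λ { (x ∷ y ∷ []) → evc x y }) (cG ∷ᶜ cH ∷ᶜ []ᶜ)

recursion-computable : ∀ F {f g} → Computable n f → Computable (2 + n) g →
  (∀ xs → F (0 ∷ xs) ≡ f xs) → (∀ k xs → F (suc k ∷ xs) ≡ g (k ∷ F (k ∷ xs) ∷ xs)) →
  Computable (suc n) F
recursion-computable F (cf , evf) (cg , evg) F-zero F-suc = prec cf cg , evF
  where
  evF : ∀ xs → prec cf cg [ xs ]⇓ F xs
  evF (zero  ∷ xs) = subst (prec cf cg [ 0 ∷ xs ]⇓_) (sym (F-zero xs)) (evPrec0 (evf xs))
  evF (suc k ∷ xs) = subst (prec cf cg [ suc k ∷ xs ]⇓_) (sym (F-suc k xs))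
    (evPrecS (evF (k ∷ xs)) (evg (k ∷ F (k ∷ xs) ∷ xs)))

suc-computable : Computable₁ suc
suc-computable = S , λ _ → evS

const-computable : ∀ k → Computable n (λ _ → k)
const-computable zero    = Z , λ _ → evZ
const-computable (suc k) = app₁ suc-computable (const-computable k)

+-computable : Computable₂ _+_
+-computable = computable₂ (recursion-computable (λ xs → head xs + lookup xs (# 1))
  (var (# 0)) (app₁ suc-computable (var (# 1))) (λ _ → refl) (λ _ _ → refl))

*-computable : Computable₂ _*_
*-computable = computable₂ (recursion-computable (λ xs → head xs * lookup xs (# 1))
  (const-computable 0) (app₂ +-computable (var (# 2)) (var (# 1))) (λ _ → refl) (λ _ _ → refl))

^-computable : ∀ a → Computable₁ (a ^_)
^-computable a = computable₁ (recursion-computable (λ xs → a ^ head xs)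
  (const-computable 1) (app₂ *-computable (const-computable a) (var (# 1)))
  (λ _ → refl) (λ _ _ → refl))

pair-computable : Computable₂ pair
pair-computable = computable₂
  (app₂ +-computable (app₁ tri-computable (app₂ +-computable (var (# 0)) (var (# 1)))) (var (# 0)))
  where
  tri-computable : Computable₁ tri
  tri-computable = computable₁ (recursion-computable (tri ∘ head)
    (const-computable 0) (app₁ suc-computable (app₂ +-computable (var (# 0)) (var (# 1))))
    (λ _ → refl) (λ _ _ → refl))

mask-computable : Computable₁ mask
mask-computable = computable₁ (recursion-computable (mask ∘ head)
  (const-computable 0) (app₁ suc-computable (app₂ *-computable (var (# 1)) (const-computable 2)))
  (λ _ → refl) (λ _ _ → refl))

%2-computable : Computable₁ (_% 2)
%2-computable = computable₁ (recursion-computable (λ xs → head xs % 2)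
  (const-computable 0) (app₁ 1∸-computable (var (# 1))) (λ _ → refl) (λ k _ → [1+n]%2≡1∸n%2 k))
  where
  1∸-computable : Computable₁ (1 ∸_)
  1∸-computable = computable₁ (recursion-computable (λ xs → 1 ∸ head xs)
    (const-computable 1) (const-computable 0) (λ _ → refl) (λ k _ → 0∸n≡0 k))

/2-computable : Computable₁ (_/ 2)
/2-computable = computable₁ (recursion-computable (λ xs → head xs / 2)
  (const-computable 0) (app₂ +-computable (var (# 1)) (app₁ %2-computable (var (# 0))))
  (λ _ → refl) (λ k _ → [1+n]/2≡n/2+n%2 k))

testBit≡[e/2^j]%2 : ∀ j e → testBit j e ≡ fold e (_/ 2) j % 2
testBit≡[e/2^j]%2 j e = trans (testBit≡iterate j e) (cong (_% 2) (sym (iterate-is-fold e (_/ 2) j)))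
  where
  testBit≡iterate : ∀ j e → testBit j e ≡ iterate (_/ 2) e j % 2
  testBit≡iterate zero    e = refl
  testBit≡iterate (suc j) e = testBit≡iterate j (e / 2)

testBit-computable : Computable₂ testBit
testBit-computable = computable₂-ext (computable₂ (app₁ %2-computable halvings-computable))
  (λ j e → sym (testBit≡[e/2^j]%2 j e))
  where
  halvings-computable : Computable 2 (λ xs → fold (lookup xs (# 1)) (_/ 2) (head xs))
  halvings-computable = recursion-computable _
    (var (# 0)) (app₁ /2-computable (var (# 1))) (λ _ → refl) (λ _ _ → refl)

sumBelow-computable : ∀ {F} → Computable (suc n) F →
  Computable (suc n) (λ xs → sumBelow (λ i → F (i ∷ tail xs)) (head xs))
sumBelow-computable {F = F} cF = recursion-computable _
  (const-computable 0) (app₂ +-computable (var (# 1)) (compose cF (var (# 0) ∷ᶜ lookups (fsuc ∘ fsuc))))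
  (λ _ → refl)
  (λ k xs → cong (λ ys → sumBelow (λ i → F (i ∷ xs)) k + F (k ∷ ys)) (sym (tabulate∘lookup xs)))

-- Truth-table reductions

ComputablyBounded : (ℕ → ℕ) → Set
ComputablyBounded h = Σ (ℕ → ℕ) (λ b → Computable₁ b × (∀ x → h x ≤ b x))

graphChar≤tt : ∀ h → graphChar h ≤tt h
graphChar≤tt h =
  (λ n → mask (suc n)) , testBit ,
  computable₁ (app₁ mask-computable (app₁ suc-computable (var (# 0)))) , testBit-computable ,
  graphChar-as-bit
  where
  graphChar-as-bit : ∀ n → graphChar h n ≡ testBit n (restrict h (mask (suc n)))
  graphChar-as-bit n = subst (λ n → graphChar h n ≡ testBit n (restrict h (mask (suc n)))) (pair-unpair n)
    (trans (graphChar-pair h x y) (sym (testBit-restrict-mask h y (s≤s (m≤pair x y)))))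
    where
    x = proj₁ (unpair n)
    y = proj₂ (unpair n)

computablyBounded⇒≤tt-graphChar : ∀ h → ComputablyBounded h → h ≤tt graphChar h
computablyBounded⇒≤tt-graphChar h (b , cb , h≤b) = p , q , cp , cq , h≡q
  where
  p : ℕ → ℕ
  p x = mask (suc (pair x (b x)))

  q : ℕ → ℕ → ℕ
  q x c = sumBelow (λ y → y * testBit (pair (pair x y) 1) c) (suc (b x))

  cp : Computable₁ p
  cp = computable₁
    (app₁ mask-computable (app₁ suc-computable (app₂ pair-computable (var (# 0)) (app₁ cb (var (# 0))))))

  cq : Computable₂ q
  cq = computable₂ (compose (sumBelow-computable summand)
    (app₁ suc-computable (app₁ cb (var (# 0))) ∷ᶜ var (# 0) ∷ᶜ var (# 1) ∷ᶜ []ᶜ))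
    where
    point = app₂ pair-computable (app₂ pair-computable (var (# 1)) (var (# 0))) (const-computable 1)
    summand = app₂ *-computable (var (# 0)) (app₂ testBit-computable point (var (# 2)))

  graph-bit : ∀ x y → y ≤ b x → testBit (pair (pair x y) 1) (restrict (graphChar h) (p x)) ≡ δ (h x) y
  graph-bit x y y≤bx = begin
    testBit (pair (pair x y) 1) (restrict (graphChar h) (p x))
      ≡⟨ testBit-restrict-mask (graphChar h) 1 (s≤s (pair-monoʳ-≤ x y≤bx)) ⟩
    δ (graphChar h (pair x y)) 1   ≡⟨ cong (λ v → δ v 1) (graphChar-pair h x y) ⟩
    δ (δ (h x) y) 1               ≡⟨ δ-δ (h x) y ⟩
    δ (h x) y                     ∎
    where open ≡-Reasoning

  h≡q : ∀ x → h x ≡ q x (restrict (graphChar h) (p x))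
  h≡q x = sym (begin
    q x (restrict (graphChar h) (p x))
      ≡⟨ sumBelow-cong (suc (b x)) (λ y y<1+bx → cong (y *_) (graph-bit x y (s≤s⁻¹ y<1+bx))) ⟩
    sumBelow (λ y → y * δ (h x) y) (suc (b x))
      ≡⟨ sumBelow-*δ (suc (b x)) (s≤s (h≤b x)) ⟩
    h x ∎)
    where open ≡-Reasoning

≤tt-01-valued⇒computablyBounded : ∀ {α β} → (∀ n → β n ≤ 1) → α ≤tt β → ComputablyBounded α
≤tt-01-valued⇒computablyBounded {α} {β} β≤1 (p , q , cp , cq , α≡q) = b , cb , α≤b
  where
  codeBound : ℕ → ℕ
  codeBound e = sumBelow (λ k → 2 ^ pair k 1) e

  b : ℕ → ℕ
  b x = sumBelow (q x) (suc (codeBound (p x)))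

  cb : Computable₁ b
  cb = computable₁ (compose (sumBelow-computable (app₂ cq (var (# 1)) (var (# 0))))
    (app₁ suc-computable (app₁ codeBound-computable (app₁ cp (var (# 0)))) ∷ᶜ var (# 0) ∷ᶜ []ᶜ))
    where
    codeBound-computable : Computable₁ codeBound
    codeBound-computable = computable₁ (sumBelow-computable
      (app₁ (^-computable 2) (app₂ pair-computable (var (# 0)) (const-computable 1))))

  α≤b : ∀ x → α x ≤ b x
  α≤b x = subst (_≤ b x) (sym (α≡q x))
    (f≤sumBelow (q x) (suc (codeBound (p x))) (s≤s (restrictBelow≤ (p x) (p x) β≤1)))

proposition2p7 : (h : ℕ → ℕ) →
    (h ≡tt graphChar h) ⇔ Σ (ℕ → ℕ) (λ b → Computable₁ b × (∀ x → h x ≤ b x))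
proposition2p7 h = mk⇔
  (λ (h≤graph , _) → ≤tt-01-valued⇒computablyBounded (graphChar≤1 h) h≤graph)
  (λ bounded → computablyBounded⇒≤tt-graphChar h bounded , graphChar≤tt h)
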